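{- For any simple temporal graph $\mathcal{G}=(V,E,\lambda)$ with lifetime $T_{\max}$ and parameters $\delta,k\in\mathbb{N}^+$, there is a Discoverer strategy that wins the ideal patient zero game in $T_{\max}\cdot|V|$ rounds.
   Context: A simple temporal graph $\mathcal{G}=(V,E,\lambda)$ with lifetime $T_{\max}$ consists of a finite undirected static graph $(V,E)$ and a labeling $\lambda:E\to\{1,\dots,T_{\max}\}$. Infection model with parameter $\delta$: all nodes start susceptible; a seed infection $(v,t)\in V\times[0,T_{\max}]$ makes $v$ infected at time $t$; otherwise a susceptible node $u$ becomes infected at time $t$ iff some node $v$ infectious at time $t$ has an edge $uv$ with $\lambda(uv)=t$ (if several, exactly one of them infects $u$). A node infected at time $t$ is infectious at times $t+1,\dots,t+\delta$ and resistant afterwards. The infection log records triples $(u,v,t)$ ($u$ infected $v$ at time $t$; seeds as $(u,u,t)$); it is consistent with a seed set if some infection chain with these seeds produces it. A node $v$ is an ideal patient zero with time $t$ (and $(v,t)$ an IPZ pair) if seed-infecting only $\{(v,t)\}$ causes every node to become infected. Ideal patient zero (IPZ) game: the Discoverer learns $V$ and $E$; in each round it submits at most $k$ seed infections and the Adversary answers with a consistent infection log; at the end the Discoverer submits either a pair $(u,t)$ (its guess for an IPZ pair) or $\bot$ (claiming none exists), and the Adversary responds with a temporal graph consistent with all infection logs; the Adversary wins if the Discoverer's pair is not an IPZ pair, or if $\bot$ was submitted but an IPZ pair exists (in the Adversary's graph); otherwise the Discoverer wins. -}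

module Defs where

open import Data.Nat using (ℕ; zero; suc; _+_; _*_; _≤_; _<_)
open import Data.Fin using (Fin)
open import Data.Product using (Σ; ∃; ∃-syntax; _×_; _,_; proj₁; proj₂)
open import Data.Sum using (_⊎_)
open import Data.Maybe using (Maybe; just; nothing)
open import Data.List using (List; []; _∷_; _++_; length)
open import Data.List.Relation.Unary.All using (All)
open import Data.List.Membership.Propositional using (_∈_; _∉_)
open import Relation.Binary.PropositionalEquality using (_≡_; _≢_)
open import Relation.Nullary using (¬_)
open import Function.Bundles using (_⇔_)

record StaticGraph : Set where
  field
    n      : ℕ
    m      : ℕ
    ends   : Fin m → Fin n × Fin n
    loopless : ∀ e → proj₁ (ends e) ≢ proj₂ (ends e)
    noMulti  : ∀ e e′ →
      (ends e ≡ ends e′ ⊎ ends e ≡ (proj₂ (ends e′) , proj₁ (ends e′))) → e ≡ e′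

open StaticGraph public

Joins : (G : StaticGraph) → Fin (m G) → Fin (n G) → Fin (n G) → Set
Joins G e u v = ends G e ≡ (u , v) ⊎ ends G e ≡ (v , u)

Labeling : StaticGraph → Set
Labeling G = Fin (m G) → ℕ

ValidLabeling : (G : StaticGraph) → ℕ → Labeling G → Set
ValidLabeling G Tmax lab = ∀ e → 1 ≤ lab e × lab e ≤ Tmax

Seeds : StaticGraph → Set
Seeds G = List (Fin (n G) × ℕ)

-- An infection chain: for every node, either never infected (nothing),
-- or infected by `u` at time `t` (just (u , t)); seeds are recorded as
-- infected by themselves.
Chain : StaticGraph → Set
Chain G = Fin (n G) → Maybe (Fin (n G) × ℕ)

-- Infection logs: triples (u , v , t) = "u infected v at time t"
Log : StaticGraph → Set
Log G = List (Fin (n G) × Fin (n G) × ℕ)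

module _ (G : StaticGraph) (δ : ℕ) (lab : Labeling G) where

  Infectious : Chain G → Fin (n G) → ℕ → Set
  Infectious c u t = ∃[ s ] ∃[ w ] (c u ≡ just (w , s) × s < t × t ≤ s + δ)

  ContactedBy : Chain G → Fin (n G) → Fin (n G) → ℕ → Set
  ContactedBy c u v t = ∃[ e ] (Joins G e u v × lab e ≡ t × Infectious c u t)

  -- v would become infected at time t if still susceptible
  Triggered : Seeds G → Chain G → Fin (n G) → ℕ → Set
  Triggered S c v t = (v , t) ∈ S ⊎ ∃[ u ] ContactedBy c u v t

  IsChain : Seeds G → Chain G → Set
  IsChain S c = ∀ v →
      (c v ≡ nothing → ∀ t → ¬ Triggered S c v t)
    × (∀ u t → c v ≡ just (u , t) →
          (∀ t′ → t′ < t → ¬ Triggered S c v t′)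
        × ((u ≡ v × (v , t) ∈ S) ⊎ ((v , t) ∉ S × ContactedBy c u v t)))

  ConsistentLog : Seeds G → Log G → Set
  ConsistentLog S L = ∃[ c ] (IsChain S c ×
    (∀ u v t → ((u , v , t) ∈ L) ⇔ (c v ≡ just (u , t))))

  IPZPair : ℕ → Fin (n G) → ℕ → Set
  IPZPair Tmax v t = t ≤ Tmax ×
    (∀ c → IsChain ((v , t) ∷ []) c → ∀ w → c w ≢ nothing)

module Game (G : StaticGraph) (Tmax δ k : ℕ) where

  record Query : Set where
    constructor query
    field
      seeds  : Seeds G
      few    : length seeds ≤ k
      inTime : All (λ p → proj₂ p ≤ Tmax) seeds

  open Query public

  History : Set
  History = List (Query × Log G)   -- Log does not depend on λ

  -- final answer: just (u , t) = guessed IPZ pair; nothing = ⊥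
  Answer : Set
  Answer = Maybe (Fin (n G) × ℕ)

  data Move : Set where
    ask   : Query → Move
    guess : Answer → Move

  Strategy : Set
  Strategy = History → Move

  Adversary : Set
  Adversary = History → Query → Log G

  run : Strategy → Adversary → ℕ → History → Maybe Answer
  run s a r h with s h
  run s a r       h | guess x = just x
  run s a zero    h | ask q   = nothing
  run s a (suc r) h | ask q   = run s a r (h ++ ((q , a h q) ∷ []))

  Correct : Labeling G → Answer → Set
  Correct lab (just (u , t)) = IPZPair G δ lab Tmax u t
  Correct lab nothing = ¬ (∃[ v ] ∃[ t ] IPZPair G δ lab Tmax v t)

  WinsWithin : Strategy → ℕ → Set
  WinsWithin s r =
    ∀ (lab : Labeling G) → ValidLabeling G Tmax lab →
    ∀ (a : Adversary) → (∀ h q → ConsistentLog G δ lab (seeds q) (a h q)) →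
    ∃[ ans ] (run s a r [] ≡ just ans × Correct lab ans)

-- Which nodes an infection chain infects, and when, does not depend on the choices made in
-- the chain: a node is infected exactly when it is first triggered, and being triggered at
-- time t only depends on the infections before t.  Hence one round seeding only (v , t)
-- decides whether (v , t) is an IPZ pair: it is iff the log names every node.  The Discoverer
-- probes the Tmax · |V| pairs with t < Tmax, one per round.  The remaining pairs (v , Tmax)
-- need no round: all labels are at most Tmax, so a seed at time Tmax infects nobody else, and
-- (v , Tmax) is an IPZ pair iff v is the only vertex.

module Submission where

open import Defs
open import Data.Nat using (ℕ; zero; suc; _+_; _*_; _≤_; _<_; _<?_)
open import Data.Nat.Properties
  using (≤-refl; <⇒≤; ≮⇒≥; <-irrefl; n≮n; ≤-<-trans; n<1+n; m<1+n⇒m<n∨m≡n; m≤n⇒m<n∨m≡n)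
open import Data.Fin using (Fin; toℕ; fromℕ<; remQuot; combine; _≟_)
open import Data.Fin.Properties using (toℕ<n; toℕ-fromℕ<; remQuot-combine; any?; all?; ¬∀⟶∃¬)
open import Data.Product using (Σ; ∃-syntax; _×_; _,_; proj₁; proj₂)
open import Data.Sum using (_⊎_; inj₁; inj₂)
open import Data.Maybe using (just; nothing)
open import Data.Maybe.Properties using (just-injective)
open import Data.Empty using (⊥-elim)
open import Data.List using (List; []; _∷_; _∷ʳ_; length; map; drop; allFin)
open import Data.List.Properties using (length-map; length-++; length-tabulate; drop-drop)
open import Data.List.Relation.Unary.All as All using (All; []; _∷_; lookupAny)
open import Data.List.Relation.Unary.All.Properties using (∷ʳ⁺; ¬Any⇒All¬)
open import Data.List.Relation.Unary.Any as Any using (Any; here; there)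
open import Data.List.Relation.Unary.Any.Properties using (lookup-result; ++⁺ˡ; ++⁺ʳ)
open import Data.List.Membership.Propositional using (_∈_; find; lose)
open import Data.List.Membership.Propositional.Properties using (∈-map⁺; ∈-allFin)
open import Relation.Binary.PropositionalEquality
  using (_≡_; _≢_; refl; sym; trans; cong; cong₂; subst; module ≡-Reasoning)
open import Relation.Nullary using (¬_; Dec; yes; no)
open import Relation.Unary using (Decidable)
open import Function using (id)
open import Function.Bundles using (_⇔_; Equivalence)


module Logs (G : StaticGraph) where

  InfectsAll : Chain G → Set
  InfectsAll c = ∀ w → c w ≢ nothing

  Records : Chain G → Log G → Set
  Records c L = ∀ u v t → ((u , v , t) ∈ L) ⇔ (c v ≡ just (u , t))

  Full : Log G → Set
  Full L = ∀ w → Any (λ entry → proj₁ (proj₂ entry) ≡ w) L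

  full? : Decidable Full
  full? L = all? (λ w → Any.any? (λ entry → proj₁ (proj₂ entry) ≟ w) L)

  module _ {c : Chain G} {L : Log G} (records : Records c L) where

    full⇒infectsAll : Full L → InfectsAll c
    full⇒infectsAll full w cw≡nothing with find (full w)
    ... | (u , .w , t) , logged , refl
        with () ← trans (sym cw≡nothing) (Equivalence.to (records u w t) logged)

    infectsAll⇒full : InfectsAll c → Full L
    infectsAll⇒full infects w with c w in cw≡
    ... | nothing = ⊥-elim (infects w cw≡)
    ... | just (u , t) = lose (Equivalence.from (records u w t) cw≡) refl

module Infection (G : StaticGraph) (δ : ℕ) (lab : Labeling G) where
  open Logs G

  private variable
    S : Seeds G
    c c′ : Chain G
    w : Fin (n G)
    s t : ℕ

  InfectedAt : Chain G → Fin (n G) → ℕ → Set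
  InfectedAt c w s = ∃[ x ] c w ≡ just (x , s)

  infectionTime-unique : InfectedAt c w s → InfectedAt c w t → s ≡ t
  infectionTime-unique (_ , eq) (_ , eq′) = cong proj₂ (just-injective (trans (sym eq) eq′))

  infected⇒triggered : IsChain G δ lab S c → InfectedAt c w s → Triggered G δ lab S c w s
  infected⇒triggered {w = w} {s = s} chain (x , eq) with proj₂ (proj₂ (chain w) x s eq)
  ... | inj₁ (_ , seeded) = inj₁ seeded
  ... | inj₂ (_ , contact) = inj₂ (x , contact)

  triggered⇒infected : IsChain G δ lab S c → Triggered G δ lab S c w t →
    ∃[ s ] (InfectedAt c w s × s ≤ t)
  triggered⇒infected {c = c} {w = w} {t = t} chain triggered with c w in eq
  ... | nothing = ⊥-elim (proj₁ (chain w) eq t triggered)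
  ... | just (x , s) with t <? s
  ...   | yes t<s = ⊥-elim (proj₁ (proj₂ (chain w) x s eq) t t<s triggered)
  ...   | no t≮s = s , (x , refl) , ≮⇒≥ t≮s

  AgreeBefore : Chain G → Chain G → ℕ → Set
  AgreeBefore c c′ t = ∀ {w s} → s < t → InfectedAt c w s → InfectedAt c′ w s

  infectious-transfer : ∀ {u} → AgreeBefore c c′ t →
    Infectious G δ lab c u t → Infectious G δ lab c′ u t
  infectious-transfer agree (s , x , eq , s<t , t≤s+δ) =
    let (x′ , eq′) = agree s<t (x , eq) in s , x′ , eq′ , s<t , t≤s+δ

  triggered-transfer : AgreeBefore c c′ t →
    Triggered G δ lab S c w t → Triggered G δ lab S c′ w t
  triggered-transfer agree (inj₁ seeded) = inj₁ seeded
  triggered-transfer {c = c} {c′ = c′} agree (inj₂ (u , e , joins , label , infectious)) =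
    inj₂ (u , e , joins , label , infectious-transfer {c = c} {c′ = c′} agree infectious)

  agreeBefore : ∀ t → IsChain G δ lab S c → IsChain G δ lab S c′ → AgreeBefore c c′ t
  agreeBefore zero _ _ ()
  agreeBefore {c = c} (suc t) chain chain′ {w} s<1+t infected with m<1+n⇒m<n∨m≡n s<1+t
  ... | inj₁ s<t = agreeBefore t chain chain′ s<t infected
  -- w, infected in c at time t, is triggered at t in c′ as well; an earlier infection of w
  -- in c′ would, by the induction hypothesis, also be one in c.
  ... | inj₂ refl with triggered⇒infected chain′
    (triggered-transfer (agreeBefore t chain chain′) (infected⇒triggered chain infected))
  ...   | s′ , infected′ , s′≤t with m≤n⇒m<n∨m≡n s′≤t
  ...     | inj₂ refl = infected′
  ...     | inj₁ s′<t = ⊥-elim (<-irrefl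
    (infectionTime-unique {c = c} {w = w} (agreeBefore t chain′ chain s′<t infected′) infected)
    s′<t)

  infectedAt-transfer : IsChain G δ lab S c → IsChain G δ lab S c′ →
    InfectedAt c w s → InfectedAt c′ w s
  infectedAt-transfer {s = s} chain chain′ = agreeBefore (suc s) chain chain′ (n<1+n s)

  infectsAll-transfer : IsChain G δ lab S c → IsChain G δ lab S c′ →
    InfectsAll c → InfectsAll c′
  infectsAll-transfer {c = c} chain chain′ infects w c′w≡nothing with c w in eq
  ... | nothing = infects w eq
  ... | just (x , s)
      with () ← trans (sym c′w≡nothing) (proj₂ (infectedAt-transfer chain chain′ (x , eq)))

  seed-infected : IsChain G δ lab S c → (w , t) ∈ S → c w ≢ nothing
  seed-infected {w = w} {t = t} chain seeded cw≡nothing =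
    proj₁ (chain w) cw≡nothing t (inj₁ seeded)

  soleVertex-IPZ : ∀ {Tmax v} → (∀ w → w ≡ v) → t ≤ Tmax → IPZPair G δ lab Tmax v t
  soleVertex-IPZ sole t≤Tmax = t≤Tmax , λ c chain w →
    subst (λ u → c u ≢ nothing) (sym (sole w)) (seed-infected chain (here refl))

  module _ (v : Fin (n G)) (t₀ : ℕ) where

    seedOnly : Chain G
    seedOnly w with w ≟ v
    ... | yes _ = just (v , t₀)
    ... | no _ = nothing

    seedOnly-missing : w ≢ v → seedOnly w ≡ nothing
    seedOnly-missing {w} w≢v with w ≟ v
    ... | yes w≡v = ⊥-elim (w≢v w≡v)
    ... | no _ = refl

    seedOnly-infectiousAfter : ∀ {u} → Infectious G δ lab seedOnly u t → t₀ < t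
    seedOnly-infectiousAfter {t = t} {u} (s , x , eq , s<t , _) with u ≟ v
    ... | yes _ = subst (_< t) (sym (cong proj₂ (just-injective eq))) s<t
    ... | no _ with () ← eq

    module _ (labels≤t₀ : ∀ e → lab e ≤ t₀) where

      seedOnly-noContact : ∀ {u} → ¬ ContactedBy G δ lab seedOnly u w t
      seedOnly-noContact (e , _ , refl , infectious) =
        n≮n (lab e) (≤-<-trans (labels≤t₀ e) (seedOnly-infectiousAfter infectious))

      seedOnly-isChain : IsChain G δ lab ((v , t₀) ∷ []) seedOnly
      seedOnly-isChain w with w ≟ v
      ... | yes refl = (λ ()) , λ { _ _ refl → notBefore , inj₁ (refl , here refl) }
        where
        notBefore : ∀ t → t < t₀ → ¬ Triggered G δ lab ((v , t₀) ∷ []) seedOnly v t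
        notBefore t t<t₀ (inj₁ (here refl)) = n≮n t t<t₀
        notBefore t t<t₀ (inj₂ (_ , contact)) = seedOnly-noContact contact
      ... | no w≢v = (λ _ → notTriggered) , λ _ _ ()
        where
        notTriggered : ∀ t → ¬ Triggered G δ lab ((v , t₀) ∷ []) seedOnly w t
        notTriggered t (inj₁ (here refl)) = w≢v refl
        notTriggered t (inj₂ (_ , contact)) = seedOnly-noContact contact

      lateSeed-notIPZ : ∀ {Tmax} → w ≢ v → ¬ IPZPair G δ lab Tmax v t₀
      lateSeed-notIPZ {w = w} w≢v (_ , infects) =
        infects seedOnly seedOnly-isChain w (seedOnly-missing w≢v)

module Run (G : StaticGraph) (Tmax δ k : ℕ) where
  open Game G Tmax δ k

  run-guess : ∀ (s : Strategy) a r h {x} → s h ≡ guess x → run s a r h ≡ just x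
  run-guess s a r h eq with s h
  run-guess s a r h refl | .(guess _) = refl

  run-ask : ∀ (s : Strategy) a r h {q} → s h ≡ ask q →
    run s a (suc r) h ≡ run s a r (h ∷ʳ (q , a h q))
  run-ask s a r h eq with s h
  run-ask s a r h refl | .(ask _) = refl

module Discoverer (G : StaticGraph) (Tmax δ k : ℕ) (1≤k : 1 ≤ k) where
  open Game G Tmax δ k
  open Run G Tmax δ k
  open Logs G

  Candidate : Set
  Candidate = Fin Tmax × Fin (n G)

  seedOf : Candidate → Fin (n G) × ℕ
  seedOf (i , v) = v , toℕ i

  probe : Candidate → Query
  probe c@(i , _) = query (seedOf c ∷ []) 1≤k (<⇒≤ (toℕ<n i) ∷ [])

  candidates : List Candidate
  candidates = map (remQuot {Tmax} (n G)) (allFin (Tmax * n G))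

  length-candidates : length candidates ≡ Tmax * n G
  length-candidates =
    trans (length-map (remQuot {Tmax} (n G)) (allFin _)) (length-tabulate {A = Fin (Tmax * n G)} id)

  ∈-candidates : ∀ c → c ∈ candidates
  ∈-candidates (i , v) =
    subst (_∈ candidates) (remQuot-combine i v)
      (∈-map⁺ (remQuot {Tmax} (n G)) (∈-allFin (combine i v)))

  Decisive : Query × Log G → Set
  Decisive (q , L) = ∃[ p ] (seeds q ≡ p ∷ [] × Full L)

  decisive? : Decidable Decisive
  decisive? (q , L) with seeds q | full? L
  ... | p ∷ [] | yes full = yes (p , refl , full)
  ... | p ∷ [] | no ¬full = no λ { (_ , refl , full) → ¬full full }
  ... | [] | _ = no λ { (_ , () , _) }
  ... | _ ∷ _ ∷ _ | _ = no λ { (_ , () , _) }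

  remaining : History → List Candidate
  remaining h = drop (length h) candidates

  remaining-∷ʳ : ∀ h x {c cs} → remaining h ≡ c ∷ cs → remaining (h ∷ʳ x) ≡ cs
  remaining-∷ʳ h x rem≡ = begin
    drop (length (h ∷ʳ x)) candidates  ≡⟨ cong (λ m → drop m candidates) (length-++ h) ⟩
    drop (length h + 1) candidates     ≡⟨ sym (drop-drop (length h) 1 candidates) ⟩
    drop 1 (remaining h)               ≡⟨ cong (drop 1) rem≡ ⟩
    _                                  ∎
    where open ≡-Reasoning

  SoleVertex : Set
  SoleVertex = Σ (Fin (n G)) λ v → ∀ w → w ≡ v

  soleVertex? : Dec SoleVertex
  soleVertex? = any? λ v → all? λ w → w ≟ v

  finalGuess : Dec SoleVertex → Answer
  finalGuess (yes (v , _)) = just (v , Tmax)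
  finalGuess (no _) = nothing

  nextMove : ∀ {h} → Dec (Any Decisive h) → List Candidate → Move
  nextMove (yes decisive) _ = guess (just (proj₁ (lookup-result decisive)))
  nextMove (no _) (c ∷ _) = ask (probe c)
  nextMove (no _) [] = guess (finalGuess soleVertex?)

  strategy : Strategy
  strategy h = nextMove (Any.any? decisive? h) (remaining h)

  Probes : Candidate → Query × Log G → Set
  Probes c (q , _) = seeds q ≡ seedOf c ∷ []

  Covered : History → Set
  Covered h = ∀ c → c ∈ remaining h ⊎ Any (Probes c) h

  covered-∷ʳ : ∀ {h c cs} → Covered h → remaining h ≡ c ∷ cs →
    ∀ L → Covered (h ∷ʳ (probe c , L))
  covered-∷ʳ {h} covered rem≡ L c′ with covered c′
  ... | inj₂ probed = inj₂ (++⁺ˡ probed)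
  ... | inj₁ c′∈rem with subst (c′ ∈_) rem≡ c′∈rem
  ...   | here refl = inj₂ (++⁺ʳ h (here refl))
  ...   | there c′∈cs = inj₁ (subst (c′ ∈_) (sym (remaining-∷ʳ h _ rem≡)) c′∈cs)

  module _ (lab : Labeling G) where
    open Infection G δ lab

    Consistent : Query × Log G → Set
    Consistent (q , L) = ConsistentLog G δ lab (seeds q) L

    decisive⇒IPZ : ∀ {e} → Consistent e → (d : Decisive e) →
      IPZPair G δ lab Tmax (proj₁ (proj₁ d)) (proj₂ (proj₁ d))
    decisive⇒IPZ {query _ _ (t≤Tmax ∷ []) , _} (c , chain , records) (_ , refl , full) =
      t≤Tmax , λ c′ chain′ → infectsAll-transfer chain chain′ (full⇒infectsAll records full)

    probed-notIPZ : ∀ {e v t} → Consistent e → ¬ Decisive e →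
      seeds (proj₁ e) ≡ (v , t) ∷ [] → ¬ IPZPair G δ lab Tmax v t
    probed-notIPZ {query _ _ _ , _} (c , chain , records) undecided refl (_ , infects) =
      undecided (_ , refl , infectsAll⇒full records (infects c chain))

    exhausted-notIPZ : ∀ {h} → All Consistent h → ¬ Any Decisive h →
      Covered h → remaining h ≡ [] →
      ∀ v t → t < Tmax → ¬ IPZPair G δ lab Tmax v t
    exhausted-notIPZ {h} consistent undecided covered rem≡[] v t t<Tmax ipz
      with covered (fromℕ< t<Tmax , v)
    ... | inj₁ c∈rem with () ← subst (_ ∈_) rem≡[] c∈rem
    ... | inj₂ probed =
      let (consistentₑ , undecidedₑ) , probes =
            lookupAny (All.zip (consistent , ¬Any⇒All¬ h undecided)) probed
      in probed-notIPZ {Any.lookup probed} consistentₑ undecidedₑ probes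
           (subst (IPZPair G δ lab Tmax v) (sym (toℕ-fromℕ< t<Tmax)) ipz)

    finalGuess-correct : ValidLabeling G Tmax lab →
      (∀ v t → t < Tmax → ¬ IPZPair G δ lab Tmax v t) →
      (d : Dec SoleVertex) → Correct lab (finalGuess d)
    finalGuess-correct _ _ (yes (_ , sole)) = soleVertex-IPZ sole ≤-refl
    finalGuess-correct valid early (no ¬sole) (v , t , ipz@(t≤Tmax , _)) with m≤n⇒m<n∨m≡n t≤Tmax
    ... | inj₁ t<Tmax = early v t t<Tmax ipz
    ... | inj₂ refl =
      let (w , w≢v) = ¬∀⟶∃¬ (n G) (_≡ v) (_≟ v) (λ all≡v → ¬sole (v , all≡v))
      in lateSeed-notIPZ v Tmax (λ e → proj₂ (valid e)) w≢v ipz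

    module _ (valid : ValidLabeling G Tmax lab) (a : Adversary)
             (consistent : ∀ h q → ConsistentLog G δ lab (seeds q) (a h q)) where

      WinsFrom : ℕ → History → Set
      WinsFrom r h = ∃[ ans ] (run strategy a r h ≡ just ans × Correct lab ans)

      -- d comes with its defining equation instead of a `with`, which would abstract
      -- `strategy h` out of the goal and so block run-guess and run-ask.
      wins : ∀ cs h → remaining h ≡ cs → All Consistent h → Covered h →
             ∀ d → Any.any? decisive? h ≡ d → WinsFrom (length cs) h
      wins _ h _ consistentₕ _ (yes decisive) dec≡ =
        _ , run-guess strategy a _ h (cong (λ d → nextMove d (remaining h)) dec≡) ,
        decisive⇒IPZ {Any.lookup decisive}
          (proj₁ (lookupAny consistentₕ decisive)) (lookup-result decisive)
      wins [] h rem≡ consistentₕ covered (no undecided) dec≡ =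
        _ , run-guess strategy a 0 h (cong₂ nextMove dec≡ rem≡) ,
        finalGuess-correct valid (exhausted-notIPZ consistentₕ undecided covered rem≡) soleVertex?
      wins (c ∷ cs) h rem≡ consistentₕ covered (no undecided) dec≡ =
        let q = probe c
            h′ = h ∷ʳ (q , a h q)
            ans , run≡ , correct =
              wins cs h′ (remaining-∷ʳ h _ rem≡) (∷ʳ⁺ consistentₕ (consistent h q))
                (covered-∷ʳ covered rem≡ (a h q)) _ refl
        in ans , trans (run-ask strategy a _ h (cong₂ nextMove dec≡ rem≡)) run≡ , correct

corollary1 : (G : StaticGraph) (Tmax δ k : ℕ) → 1 ≤ δ → 1 ≤ k →
    ∃[ s ] Game.WinsWithin G Tmax δ k s (Tmax * n G)
corollary1 G Tmax δ k _ 1≤k = strategy , λ lab valid a consistent →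
  subst (λ r → WinsFrom lab valid a consistent r []) length-candidates
    (wins lab valid a consistent candidates [] refl [] (λ c → inj₁ (∈-candidates c)) _ refl)
  where open Discoverer G Tmax δ k 1≤k
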